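{- Let $(A,\le)$ be a partially ordered set, $a\in A$, $w\in A_a^*$ and $n\in\mathbb{N}$. Any two $a$-extensions of $w$ of length $n$ are either identical or incomparable in the product poset $A^n$.
   Context: All order relations are reflexive. For a set $X$, $X^*$ is the free monoid of finite words over $X$. $A^n$ is identified with the words of length $n$ over $A$, ordered by the product order ($v\le w$ iff the $i$-th letters satisfy $v_i\le w_i$ in $A$ for all $i$). $A_a=A\setminus\{a\}$, $A_a^*=(A\setminus\{a\})^*$. A word $w'\in A^*$ is an $a$-extension of $w\in A_a^*$ if $w'$ is obtained from $w$ by inserting finitely many (possibly zero) copies of the letter $a$ at arbitrary positions. -}

module Defs where

open import Level using (Level; _⊔_)
open import Data.List using (List; []; _∷_)
open import Relation.Binary.Core using (Rel)
open import Relation.Binary.Bundles using (Poset)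
open import Data.List.Relation.Binary.Pointwise using (Pointwise)

data IsExtension {c ℓ : Level} {C : Set c} (_≈_ : Rel C ℓ) (a : C)
     : List C → List C → Set (c ⊔ ℓ) where
  ext-[] : IsExtension _≈_ a [] []
  ext-a  : ∀ {w w' x} → x ≈ a → IsExtension _≈_ a w w' → IsExtension _≈_ a w (x ∷ w')
  ext-∷  : ∀ {w w' x y} → x ≈ y → IsExtension _≈_ a w w' → IsExtension _≈_ a (x ∷ w) (y ∷ w')

module _ {c ℓ₁ ℓ₂ : Level} (P : Poset c ℓ₁ ℓ₂) where
  open Poset P

  _≤ᵂ_ : Rel (List Carrier) (c ⊔ ℓ₂)
  _≤ᵂ_ = Pointwise _≤_

  _≈ᵂ_ : Rel (List Carrier) (c ⊔ ℓ₁)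
  _≈ᵂ_ = Pointwise _≈_

  _IsExtOf_by_ : List Carrier → List Carrier → Carrier → Set (c ⊔ ℓ₁)
  w' IsExtOf w by a = IsExtension _≈_ a w w'

-- Compare two a-extensions v₁ ≤ v₂ of w letter by letter. While both words
-- place their letters at the same positions they agree. If at some position
-- v₁ shows an inserted a while v₂ shows a letter y of w, then a < y, and from
-- then on v₁ lags behind v₂ in reading w: the letters of w that v₂ has read but
-- v₁ has not form a nonempty queue of letters strictly above a. Comparing
-- v₁ ≤ v₂ position by position keeps this invariant (a queued letter opposite
-- an a in v₂ would give a < h ≤ a), so v₁ never catches up, contradicting that
-- both words have the same length. The mirror case is the same argument in the
-- dual poset.
module Submission where

open import Defs
open import Level using (Level)
open import Data.List using (List; length; []; _∷_; _++_; _∷ʳ_)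
open import Data.List.Properties using (∷ʳ-++)
open import Data.List.Relation.Unary.All using (All; []; _∷_)
open import Data.List.Relation.Unary.All.Properties using (∷ʳ⁺)
open import Data.List.Relation.Binary.Pointwise using (Pointwise; []; _∷_)
import Data.List.Relation.Binary.Pointwise.Properties as Pointwise
open import Data.Nat using (ℕ)
open import Data.Product using (proj₁)
open import Data.Sum using (_⊎_; inj₁; inj₂)
open import Data.Empty using (⊥-elim)
open import Function using (id; _∘_)
open import Relation.Nullary using (¬_)
open import Relation.Binary.PropositionalEquality using (_≡_; cong; sym; subst)
open import Relation.Binary.Bundles using (Poset)
import Relation.Binary.Properties.Poset as PosetProperties

module _ {c ℓ₁ ℓ₂ : Level} (P : Poset c ℓ₁ ℓ₂) where
  open Poset P
  open PosetProperties P using (_<_; ≤∧≉⇒<; <⇒≱)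

  ≤-resp-≈₂ : ∀ {x x' y y'} → x ≈ x' → y ≈ y' → x' ≤ y' → x ≤ y
  ≤-resp-≈₂ x≈x' y≈y' = ≤-respˡ-≈ (Eq.sym x≈x') ∘ ≤-respʳ-≈ (Eq.sym y≈y')

  enqueue : ∀ {a} h t y u {v} → IsExtension _≈_ a (h ∷ t ++ y ∷ u) v →
            IsExtension _≈_ a (h ∷ (t ∷ʳ y) ++ u) v
  enqueue {a} h t y u {v} = subst (λ xs → IsExtension _≈_ a xs v) (cong (h ∷_) (sym (∷ʳ-++ t y u)))

  lagging-extension-≰ : ∀ {a} h t {u v₁ v₂} → All (a <_) (h ∷ t) → All (_≉ a) u →
    IsExtension _≈_ a (h ∷ t ++ u) v₁ → IsExtension _≈_ a u v₂ →
    ¬ Pointwise _≤_ v₁ v₂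
  lagging-extension-≰ h t a<q u≉a (ext-a _ e₁) (ext-a _ e₂) (_ ∷ v₁≤v₂) =
    lagging-extension-≰ h t a<q u≉a e₁ e₂ v₁≤v₂
  lagging-extension-≰ {a} h t {y ∷ u} a<q (y≉a ∷ u≉a) (ext-a x≈a e₁) (ext-∷ y≈y' e₂) (x≤y' ∷ v₁≤v₂) =
    lagging-extension-≰ h (t ∷ʳ y) (∷ʳ⁺ a<q a<y) u≉a (enqueue h t y u e₁) e₂ v₁≤v₂
    where
    a<y : a < y
    a<y = ≤∧≉⇒< (≤-resp-≈₂ (Eq.sym x≈a) y≈y' x≤y') (y≉a ∘ Eq.sym)
  lagging-extension-≰ h t (a<h ∷ _) _ (ext-∷ h≈x _) (ext-a x'≈a _) (x≤x' ∷ _) =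
    <⇒≱ a<h (≤-resp-≈₂ h≈x (Eq.sym x'≈a) x≤x')
  lagging-extension-≰ {a} h [] {y ∷ u} (a<h ∷ []) (y≉a ∷ u≉a) (ext-∷ h≈x e₁) (ext-∷ y≈y' e₂) (x≤y' ∷ v₁≤v₂) =
    lagging-extension-≰ y [] (a<y ∷ []) u≉a e₁ e₂ v₁≤v₂
    where
    a<y : a < y
    a<y = ≤∧≉⇒< (trans (proj₁ a<h) (≤-resp-≈₂ h≈x y≈y' x≤y')) (y≉a ∘ Eq.sym)
  lagging-extension-≰ {a} h (h' ∷ t) {y ∷ u} (a<h ∷ a<q) (y≉a ∷ u≉a) (ext-∷ h≈x e₁) (ext-∷ y≈y' e₂) (x≤y' ∷ v₁≤v₂) =
    lagging-extension-≰ h' (t ∷ʳ y) (∷ʳ⁺ a<q a<y) u≉a (enqueue h' t y u e₁) e₂ v₁≤v₂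
    where
    a<y : a < y
    a<y = ≤∧≉⇒< (trans (proj₁ a<h) (≤-resp-≈₂ h≈x y≈y' x≤y')) (y≉a ∘ Eq.sym)

module _ {c ℓ₁ ℓ₂ : Level} (P : Poset c ℓ₁ ℓ₂) where
  open Poset P
  open PosetProperties P using (_<_; ≤∧≉⇒<; ≥-poset)
  private module Dual = PosetProperties ≥-poset

  extension-≤⇒≈ : ∀ {a w v₁ v₂} → All (_≉ a) w →
    IsExtension _≈_ a w v₁ → IsExtension _≈_ a w v₂ →
    Pointwise _≤_ v₁ v₂ → Pointwise _≈_ v₁ v₂
  extension-≤⇒≈ _ ext-[] ext-[] [] = []
  extension-≤⇒≈ w≉a (ext-a x≈a e₁) (ext-a x'≈a e₂) (_ ∷ v₁≤v₂) =
    Eq.trans x≈a (Eq.sym x'≈a) ∷ extension-≤⇒≈ w≉a e₁ e₂ v₁≤v₂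
  extension-≤⇒≈ (_ ∷ w≉a) (ext-∷ h≈x e₁) (ext-∷ h≈x' e₂) (_ ∷ v₁≤v₂) =
    Eq.trans (Eq.sym h≈x) h≈x' ∷ extension-≤⇒≈ w≉a e₁ e₂ v₁≤v₂
  extension-≤⇒≈ {a} {h ∷ _} (h≉a ∷ w≉a) (ext-a x≈a e₁) (ext-∷ h≈x' e₂) (x≤x' ∷ v₁≤v₂) =
    ⊥-elim (lagging-extension-≰ P h [] (a<h ∷ []) w≉a e₁ e₂ v₁≤v₂)
    where
    a<h : a < h
    a<h = ≤∧≉⇒< (≤-resp-≈₂ P (Eq.sym x≈a) h≈x' x≤x') (h≉a ∘ Eq.sym)
  extension-≤⇒≈ {a} {h ∷ _} (h≉a ∷ w≉a) (ext-∷ h≈x e₁) (ext-a x'≈a e₂) (x≤x' ∷ v₁≤v₂) =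
    ⊥-elim (lagging-extension-≰ ≥-poset h [] (a>h ∷ []) w≉a e₂ e₁ (Pointwise.symmetric id v₁≤v₂))
    where
    a>h : a Dual.< h
    a>h = Dual.≤∧≉⇒< (≤-resp-≈₂ P h≈x (Eq.sym x'≈a) x≤x') (h≉a ∘ Eq.sym)

mainTheorem3 : ∀ {c ℓ₁ ℓ₂ : Level} (P : Poset c ℓ₁ ℓ₂) (a : Poset.Carrier P)
    (w : List (Poset.Carrier P)) → All (λ x → ¬ Poset._≈_ P x a) w → (n : ℕ)
    (v₁ v₂ : List (Poset.Carrier P)) →
    _IsExtOf_by_ P v₁ w a → length v₁ ≡ n →
    _IsExtOf_by_ P v₂ w a → length v₂ ≡ n →
    (_≤ᵂ_ P v₁ v₂ ⊎ _≤ᵂ_ P v₂ v₁) → _≈ᵂ_ P v₁ v₂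
mainTheorem3 P a w w≉a n v₁ v₂ e₁ _ e₂ _ (inj₁ v₁≤v₂) = extension-≤⇒≈ P w≉a e₁ e₂ v₁≤v₂
mainTheorem3 P a w w≉a n v₁ v₂ e₁ _ e₂ _ (inj₂ v₂≤v₁) =
  Pointwise.symmetric (Poset.Eq.sym P) (extension-≤⇒≈ P w≉a e₂ e₁ v₂≤v₁)
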